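{- Let $G$ be a finite simple graph. Then $$|E(G)|\geq \alpha(G)-c(G)+\Gamma(\alpha(G),\tau(G)).$$
   Context: $\alpha(G)$ is the maximum cardinality of a stable (independent) set of $G$, $\tau(G)$ is the minimum cardinality of a vertex cover of $G$, and $c(G)$ is the number of connected components of $G$. For natural numbers $a,t$, $$\Gamma(a,t)=\min\left\{\sum_{i=1}^{a}\binom{z_i}{2} : z_1+\cdots+z_a=a+t,\ z_i\in\mathbb{Z},\ z_i\geq 0\ \forall i\right\}.$$ -}

module Defs where

open import Data.Nat using (ℕ; zero; suc; _+_; _<_)
open import Data.Nat.Combinatorics using (_C_)
open import Data.Bool using (Bool; true; false)
open import Data.Fin using (Fin; toℕ)
import Data.Fin as F
open import Data.Fin.Subset using (Subset; _∈_; ∣_∣)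
open import Data.Product using (Σ; _×_; _,_; ∃)
open import Data.Sum using (_⊎_)
open import Relation.Nullary using (yes; no)
open import Data.Nat using (_<?_)
open import Relation.Binary.PropositionalEquality using (_≡_)
open import Function.Definitions using (Surjective)

sumFin : {n : ℕ} → (Fin n → ℕ) → ℕ
sumFin {zero} f = 0
sumFin {suc n} f = f F.zero + sumFin (λ i → f (F.suc i))

record Graph (n : ℕ) : Set where
  field
    adj    : Fin n → Fin n → Bool
    sym    : ∀ i j → adj i j ≡ adj j i
    irrefl : ∀ i → adj i i ≡ false
open Graph public

edgeIndicator : {n : ℕ} → Graph n → Fin n → Fin n → ℕ
edgeIndicator G i j with toℕ i <? toℕ j | adj G i j
... | yes _ | true = 1
... | _     | _    = 0

numEdges : {n : ℕ} → Graph n → ℕ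
numEdges G = sumFin (λ i → sumFin (λ j → edgeIndicator G i j))

IsStable : {n : ℕ} → Graph n → Subset n → Set
IsStable G S = ∀ i j → i ∈ S → j ∈ S → adj G i j ≡ false

IsVertexCover : {n : ℕ} → Graph n → Subset n → Set
IsVertexCover G S = ∀ i j → adj G i j ≡ true → i ∈ S ⊎ j ∈ S

IsStabilityNumber : {n : ℕ} → Graph n → ℕ → Set
IsStabilityNumber G a =
  Σ _ (λ S → IsStable G S × ∣ S ∣ ≡ a) × (∀ S → IsStable G S → ∣ S ∣ Data.Nat.≤ a)

IsCoverNumber : {n : ℕ} → Graph n → ℕ → Set
IsCoverNumber G t =
  Σ _ (λ S → IsVertexCover G S × ∣ S ∣ ≡ t) × (∀ S → IsVertexCover G S → t Data.Nat.≤ ∣ S ∣)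

data Walk {n : ℕ} (G : Graph n) : Fin n → Fin n → Set where
  here : ∀ {u} → Walk G u u
  step : ∀ {u v w} → adj G u v ≡ true → Walk G v w → Walk G u w

-- k = c(G): the connected components are exactly the fibres of a
-- surjection onto Fin k
IsNumComponents : {n : ℕ} → Graph n → ℕ → Set
IsNumComponents {n} G k =
  Σ (Fin n → Fin k) λ comp →
    Surjective _≡_ _≡_ comp ×
    (∀ u v → (comp u ≡ comp v → Walk G u v) × (Walk G u v → comp u ≡ comp v))

IsGamma : ℕ → ℕ → ℕ → Set
IsGamma a t g =
  Σ (Fin a → ℕ) (λ z → sumFin z ≡ a + t × sumFin (λ i → z i C 2) ≡ g) ×
  (∀ (z : Fin a → ℕ) → sumFin z ≡ a + t → g Data.Nat.≤ sumFin (λ i → z i C 2))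

module Submission where

-- Let L be a set of live vertices such that every vertex outside L is isolated, and let a be
-- the stability number of G restricted to L. By induction on |E| + |L| we find z₁ … zₐ with
-- Σ zᵢ = |L| and a + Σ C(zᵢ,2) + (n − |L|) ≤ |E| + c(G); for L = V this gives the theorem, as
-- n = α + τ. A live isolated vertex leaves L and contributes a part zᵢ = 1. An edge whose
-- deletion does not raise the stability number is deleted: one edge fewer, at most one
-- component more. Otherwise every edge is critical. Let v have maximum degree Δ, delete all
-- edges at v and remove v from L. Two critical edges vx, vy give stable sets of size a + 1 in
-- G − vx and G − vy; exchanging them along the component of x in G − v yields two stable sets
-- of G of total size at least 2a + 1 unless x and y are connected in G − v, so again at most
-- one component appears. A maximum stable set dominates L, hence |L| ≤ a(Δ + 1), some zᵢ is at
-- most Δ, and adding v to that part creates at most Δ new pairs, paid for by the Δ deleted edges.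

open import Defs renaming (sym to adj-sym)

open import Data.Nat.Properties hiding (_≟_)
open import Algebra.Properties.Semiring.Sum +-*-semiring
  using (sum; sum-cong-≗; ∑-distrib-+; ∑-comm; sum-remove; *-distribˡ-sum; *-distribʳ-sum)
open import Data.Bool using (Bool; true; false; not; _∧_; _∨_; if_then_else_)
open import Data.Bool.Properties
  using (¬-not; ∧-conicalˡ; ∧-conicalʳ; ∧-identityʳ; ∧-zeroʳ; ∧-comm; ∨-comm)
  renaming (_≟_ to _≟ᵇ_)
open import Data.Empty using (⊥-elim)
open import Data.Fin using (Fin; _≟_; punchIn; punchOut)
import Data.Fin as F
import Data.Fin.Properties as FinP
import Data.Fin.Subset as Subset
import Data.Fin.Subset.Properties as SubsetP
open import Data.List.Base using (allFin)
open import Data.List.Extrema.Nat using (argmax; f[xs]≤f[argmax])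
open import Data.List.Membership.Propositional.Properties using (∈-allFin)
import Data.List.Relation.Unary.All as All
open import Data.Nat using (ℕ; zero; suc; _+_; _*_; _∸_; _≤_; _<_; z≤n; s≤s; _≤?_)
open import Data.Nat.Combinatorics using (_C_; nC1≡n; nCk+nC[k+1]≡[n+1]C[k+1])
open import Data.Nat.Tactic.RingSolver using (solve-∀)
open import Data.Product using (Σ; _×_; _,_; proj₁; proj₂; ∃)
open import Data.Sum using (_⊎_; inj₁; inj₂)
import Data.Vec as Vec
import Data.Vec.Properties as VecP
open import Data.Vec.Functional using (updateAt; _∷_)
import Data.Vec.Functional.Properties as VecFP
open import Function using (_∘_; const)
open import Function.Definitions using (Surjective)
open import Relation.Binary.PropositionalEquality
open import Relation.Nullary using (¬_; ¬?; Dec; yes; no; does; contradiction)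
open import Relation.Nullary.Decidable using (dec-true; dec-false; _→-dec_; _×-dec_)

-- Sums over Fin

sumFin≡sum : ∀ {n} (f : Fin n → ℕ) → sumFin f ≡ sum f
sumFin≡sum {zero}  f = refl
sumFin≡sum {suc _} f = cong (f F.zero +_) (sumFin≡sum (f ∘ F.suc))

sum-mono-≤ : ∀ {n} {f g : Fin n → ℕ} → (∀ i → f i ≤ g i) → sum f ≤ sum g
sum-mono-≤ {zero}  f≤g = z≤n
sum-mono-≤ {suc _} f≤g = +-mono-≤ (f≤g F.zero) (sum-mono-≤ (f≤g ∘ F.suc))

sum-const : ∀ n k → sum {n} (const k) ≡ n * k
sum-const zero    k = refl
sum-const (suc n) k = cong (k +_) (sum-const n k)

≤-sum : ∀ {n} (f : Fin n → ℕ) v → f v ≤ sum f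
≤-sum {suc _} f v = ≤-trans (m≤m+n (f v) _) (≤-reflexive (sym (sum-remove {i = v} f)))

sum-update : ∀ {n} (f g : Fin n → ℕ) v → (∀ i → i ≢ v → f i ≡ g i) →
             sum f + g v ≡ sum g + f v
sum-update {suc _} f g v f≗g = begin
  sum f + g v                         ≡⟨ cong (_+ g v) (sum-remove {i = v} f) ⟩
  f v + sum (f ∘ punchIn v) + g v     ≡⟨ cong (λ s → f v + s + g v) rest ⟩
  f v + sum (g ∘ punchIn v) + g v     ≡⟨ swap-ends (f v) _ (g v) ⟩
  g v + sum (g ∘ punchIn v) + f v     ≡⟨ cong (_+ f v) (sum-remove {i = v} g) ⟨
  sum g + f v                         ∎
  where
  open ≡-Reasoning
  rest : sum (f ∘ punchIn v) ≡ sum (g ∘ punchIn v)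
  rest = sum-cong-≗ (λ j → f≗g (punchIn v j) (FinP.punchInᵢ≢i v j))
  swap-ends : ∀ a b c → a + b + c ≡ c + b + a
  swap-ends = solve-∀

sum₂ : ∀ {m n} → (Fin m → Fin n → ℕ) → ℕ
sum₂ f = sum (λ i → sum (f i))

sum₂-cong : ∀ {m n} {f g : Fin m → Fin n → ℕ} → (∀ i j → f i j ≡ g i j) →
            sum₂ f ≡ sum₂ g
sum₂-cong f≗g = sum-cong-≗ (λ i → sum-cong-≗ (f≗g i))

sum₂-distrib-+ : ∀ {m n} (f g : Fin m → Fin n → ℕ) →
                 sum₂ (λ i j → f i j + g i j) ≡ sum₂ f + sum₂ g
sum₂-distrib-+ f g = trans (sum-cong-≗ (λ i → ∑-distrib-+ (f i) (g i)))
                           (∑-distrib-+ (λ i → sum (f i)) (λ i → sum (g i)))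

ind : Bool → ℕ
ind true  = 1
ind false = 0

_==_ : ∀ {n} → Fin n → Fin n → Bool
i == j = does (i ≟ j)

==-refl : ∀ {n} (i : Fin n) → (i == i) ≡ true
==-refl i = dec-true (i ≟ i) refl

==-≢ : ∀ {n} {i j : Fin n} → i ≢ j → (i == j) ≡ false
==-≢ {i = i} {j} = dec-false (i ≟ j)

≡⇒== : ∀ {n} {i j : Fin n} → i ≡ j → (i == j) ≡ true
≡⇒== {i = i} {j} = dec-true (i ≟ j)

==⇒≡ : ∀ {n} {i j : Fin n} → (i == j) ≡ true → i ≡ j
==⇒≡ {i = i} {j} eq with i ≟ j
... | yes i≡j = i≡j

sum-δ : ∀ {n} (v : Fin n) (f : Fin n → ℕ) → sum (λ i → ind (i == v) * f i) ≡ f v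
sum-δ {n} v f = begin
  sum δf                    ≡⟨ +-identityʳ (sum δf) ⟨
  sum δf + 0                ≡⟨ sum-update δf (const 0) v off ⟩
  sum {n} (const 0) + δf v  ≡⟨ cong₂ (λ s b → s + ind b * f v)
                                      (trans (sum-const n 0) (*-zeroʳ n)) (==-refl v) ⟩
  f v + 0                   ≡⟨ +-identityʳ (f v) ⟩
  f v                       ∎
  where
  open ≡-Reasoning
  δf = λ i → ind (i == v) * f i
  off : ∀ i → i ≢ v → δf i ≡ 0
  off i i≢v rewrite ==-≢ i≢v = refl

sum-ind-== : ∀ {n} (v : Fin n) → sum (λ i → ind (i == v)) ≡ 1
sum-ind-== v = trans (sum-cong-≗ (λ i → sym (*-identityʳ (ind (i == v))))) (sum-δ v (const 1))

sum₂-ind-== : ∀ {n} (u v : Fin n) → sum₂ (λ i j → ind (i == u) * ind (j == v)) ≡ 1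
sum₂-ind-== u v = begin
  sum₂ (λ i j → ind (i == u) * ind (j == v))
    ≡⟨ sum-cong-≗ (λ i → *-distribˡ-sum (ind (i == u)) (λ j → ind (j == v))) ⟨
  sum (λ i → ind (i == u) * sum (λ j → ind (j == v)))
    ≡⟨ sum-cong-≗ (λ i → cong (ind (i == u) *_) (sum-ind-== v)) ⟩
  sum (λ i → ind (i == u) * 1)
    ≡⟨ sum-δ u (const 1) ⟩
  1 ∎
  where open ≡-Reasoning

false≢true : false ≢ true
false≢true ()

suc-+ʳ : ∀ x {y z} → y + 1 ≡ z → suc (x + y) ≡ x + z
suc-+ʳ x {y} y+1≡z = trans (sym (+-suc x y)) (cong (x +_) (trans (+-comm 1 y) y+1≡z))

suc-C2 : ∀ x → suc x C 2 ≡ x C 2 + x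
suc-C2 x = trans (sym (nCk+nC[k+1]≡[n+1]C[k+1] x 1)) (trans (cong (_+ x C 2) (nC1≡n x)) (+-comm x _))

enlarge-small-part : ∀ {a} (z : Fin a → ℕ) Δ → sum z < a * suc Δ →
  Σ (Fin a → ℕ) λ z⁺ → sum z⁺ ≡ suc (sum z) × sum (λ i → z⁺ i C 2) ≤ sum (λ i → z i C 2) + Δ
enlarge-small-part {a} z Δ small with FinP.any? (λ i → z i ≤? Δ)
... | no none = ⊥-elim (<⇒≱ small (begin
  a * suc Δ              ≡⟨ sum-const a (suc Δ) ⟨
  sum {a} (const (suc Δ)) ≤⟨ sum-mono-≤ (λ i → ≰⇒> (λ zi≤Δ → none (i , zi≤Δ))) ⟩
  sum z                  ∎))
  where open ≤-Reasoning
... | yes (i , zi≤Δ) = z⁺ , size , pairs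
  where
  z⁺ = updateAt z i suc
  others : ∀ j → j ≢ i → z⁺ j ≡ z j
  others j j≢i = VecFP.updateAt-minimal j i z j≢i
  size : sum z⁺ ≡ suc (sum z)
  size = +-cancelʳ-≡ (z i) _ _ (begin
    sum z⁺ + z i           ≡⟨ sum-update z⁺ z i others ⟩
    sum z + z⁺ i           ≡⟨ cong (sum z +_) (VecFP.updateAt-updates i z) ⟩
    sum z + suc (z i)      ≡⟨ +-suc (sum z) (z i) ⟩
    suc (sum z) + z i      ∎)
    where open ≡-Reasoning
  C⁺ C₀ : Fin a → ℕ
  C⁺ j = z⁺ j C 2
  C₀ j = z j C 2
  pairs-eq : sum C⁺ ≡ sum C₀ + z i
  pairs-eq = +-cancelʳ-≡ (z i C 2) _ _ (begin
    sum C⁺ + z i C 2        ≡⟨ sum-update C⁺ C₀ i (λ j j≢i → cong (_C 2) (others j j≢i)) ⟩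
    sum C₀ + z⁺ i C 2       ≡⟨ cong (λ y → sum C₀ + y C 2) (VecFP.updateAt-updates i z) ⟩
    sum C₀ + suc (z i) C 2  ≡⟨ cong (sum C₀ +_) (trans (suc-C2 (z i)) (+-comm _ (z i))) ⟩
    sum C₀ + (z i + z i C 2) ≡⟨ +-assoc (sum C₀) _ _ ⟨
    sum C₀ + z i + z i C 2  ∎)
    where open ≡-Reasoning
  pairs : sum C⁺ ≤ sum C₀ + Δ
  pairs = ≤-trans (≤-reflexive pairs-eq) (+-monoʳ-≤ (sum C₀) zi≤Δ)

-- Counting edges

degree : ∀ {n} → Graph n → Fin n → ℕ
degree G v = sum (λ j → ind (adj G v j))

degreeSum : ∀ {n} → Graph n → ℕ
degreeSum G = sum (degree G)

edgeIndicator-both : ∀ {n} (G : Graph n) i j →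
                     edgeIndicator G i j + edgeIndicator G j i ≡ ind (adj G i j)
edgeIndicator-both G i j rewrite adj-sym G j i
  with F.toℕ i <? F.toℕ j | F.toℕ j <? F.toℕ i | adj G i j in ij
... | yes i<j | yes j<i | _     = ⊥-elim (<-asym i<j j<i)
... | yes _   | no _    | true  = refl
... | yes _   | no _    | false = refl
... | no _    | yes _   | true  = refl
... | no _    | yes _   | false = refl
... | no i≮j  | no j≮i  | b with FinP.toℕ-injective (≤-antisym (≮⇒≥ j≮i) (≮⇒≥ i≮j))
...   | refl = cong ind (trans (sym (irrefl G i)) ij)

handshake : ∀ {n} (G : Graph n) → degreeSum G ≡ numEdges G + numEdges G
handshake G = begin
  degreeSum G                           ≡⟨ sum₂-cong (λ i j → edgeIndicator-both G i j) ⟨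
  sum₂ (λ i j → e i j + e j i)          ≡⟨ sum₂-distrib-+ e (λ i j → e j i) ⟩
  sum₂ e + sum₂ (λ i j → e j i)         ≡⟨ cong (sum₂ e +_) (∑-comm (λ j i → e j i)) ⟨
  sum₂ e + sum₂ e                       ≡⟨ cong₂ _+_ sum₂≡ sum₂≡ ⟩
  numEdges G + numEdges G               ∎
  where
  open ≡-Reasoning
  e = edgeIndicator G
  sum₂≡ : sum₂ e ≡ numEdges G
  sum₂≡ = sym (trans (sumFin≡sum (λ i → sumFin (e i)))
                     (sum-cong-≗ (λ i → sumFin≡sum (e i))))

_⊆ᴳ_ : ∀ {n} → Graph n → Graph n → Set
H ⊆ᴳ G = ∀ i j → adj H i j ≡ true → adj G i j ≡ true

SymmetricRel : ℕ → Set
SymmetricRel n = Σ (Fin n → Fin n → Bool) λ R → ∀ i j → R i j ≡ R j i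

removeEdges : ∀ {n} → Graph n → SymmetricRel n → Graph n
removeEdges G (R , R-sym) = record
  { adj    = λ i j → adj G i j ∧ not (R i j)
  ; sym    = λ i j → cong₂ (λ b c → b ∧ not c) (adj-sym G i j) (R-sym i j)
  ; irrefl = λ i → cong (_∧ not (R i i)) (irrefl G i)
  }

removeEdges-⊆ : ∀ {n} (G : Graph n) R → removeEdges G R ⊆ᴳ G
removeEdges-⊆ G R i j ij with adj G i j
... | true = refl

removeEdges-keeps : ∀ {n} (G : Graph n) R {i j} → proj₁ R i j ≡ false →
                    adj (removeEdges G R) i j ≡ adj G i j
removeEdges-keeps G R {i} {j} Rij rewrite Rij = ∧-identityʳ (adj G i j)

numEdges-removeEdges : ∀ {n} (G : Graph n) R k →
                       sum₂ (λ i j → ind (proj₁ R i j ∧ adj G i j)) ≡ k + k →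
                       numEdges G ≡ numEdges (removeEdges G R) + k
numEdges-removeEdges G R k removed≡ = double-injective (begin
  numEdges G + numEdges G               ≡⟨ handshake G ⟨
  degreeSum G                           ≡⟨ sum₂-cong split ⟩
  sum₂ (λ i j → kept i j + gone i j)    ≡⟨ sum₂-distrib-+ kept gone ⟩
  degreeSum G' + sum₂ gone              ≡⟨ cong₂ _+_ (handshake G') removed≡ ⟩
  (e' + e') + (k + k)                   ≡⟨ +-double-distrib e' k ⟩
  (e' + k) + (e' + k)                   ∎)
  where
  open ≡-Reasoning
  G' = removeEdges G R
  e' = numEdges G'
  kept gone : _ → _ → ℕ
  kept i j = ind (adj G' i j)
  gone i j = ind (proj₁ R i j ∧ adj G i j)
  split : ∀ i j → ind (adj G i j) ≡ kept i j + gone i j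
  split i j with adj G i j | proj₁ R i j
  ... | true  | true  = refl
  ... | true  | false = refl
  ... | false | true  = refl
  ... | false | false = refl
  +-double-distrib : ∀ x y → (x + x) + (y + y) ≡ (x + y) + (x + y)
  +-double-distrib = solve-∀
  double-injective : ∀ {x y} → x + x ≡ y + y → x ≡ y
  double-injective {x} {y} eq = *-cancelˡ-≡ x y 2 (trans (twice x) (trans eq (sym (twice y))))
    where
    twice : ∀ z → 2 * z ≡ z + z
    twice = solve-∀

joining : ∀ {n} → Fin n → Fin n → SymmetricRel n
joining u v = (λ i j → (i == u ∧ j == v) ∨ (i == v ∧ j == u))
            , (λ i j → trans (cong₂ _∨_ (∧-comm (i == u) (j == v)) (∧-comm (i == v) (j == u)))
                             (∨-comm (j == v ∧ i == u) _))

touching : ∀ {n} → Fin n → SymmetricRel n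
touching v = (λ i j → i == v ∨ j == v) , (λ i j → ∨-comm (i == v) _)

deleteEdge : ∀ {n} → Graph n → Fin n → Fin n → Graph n
deleteEdge G u v = removeEdges G (joining u v)

isolate : ∀ {n} → Graph n → Fin n → Graph n
isolate G v = removeEdges G (touching v)

joining-true : ∀ {n} {u v w w' : Fin n} → proj₁ (joining u v) w w' ≡ true →
               (w ≡ u × w' ≡ v) ⊎ (w ≡ v × w' ≡ u)
joining-true {u = u} {v} {w} {w'} joins with w ≟ u | w' ≟ v | w ≟ v | w' ≟ u
... | yes w≡u | yes w'≡v | _       | _       = inj₁ (w≡u , w'≡v)
... | yes _   | no _     | yes w≡v | yes w'≡u = inj₂ (w≡v , w'≡u)
... | no _    | _        | yes w≡v | yes w'≡u = inj₂ (w≡v , w'≡u)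
... | yes _   | no _     | yes _   | no _    = ⊥-elim (false≢true joins)
... | yes _   | no _     | no _    | _       = ⊥-elim (false≢true joins)
... | no _    | _        | yes _   | no _    = ⊥-elim (false≢true joins)
... | no _    | _        | no _    | _       = ⊥-elim (false≢true joins)

joining-outside : ∀ {n} {u v w s : Fin n} → s ≢ u → s ≢ v → proj₁ (joining u v) w s ≡ false
joining-outside {u = u} {v} {w} s≢u s≢v
  rewrite ==-≢ s≢u | ==-≢ s≢v | ∧-zeroʳ (w == u) | ∧-zeroʳ (w == v) = refl

numEdges-deleteEdge : ∀ {n} (G : Graph n) {u v} → adj G u v ≡ true →
                      numEdges G ≡ numEdges (deleteEdge G u v) + 1
numEdges-deleteEdge G {u} {v} uv = numEdges-removeEdges G (joining u v) 1 (begin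
  sum₂ (λ i j → ind (proj₁ (joining u v) i j ∧ adj G i j))  ≡⟨ sum₂-cong removed ⟩
  sum₂ (λ i j → at-uv i j + at-vu i j)                      ≡⟨ sum₂-distrib-+ at-uv at-vu ⟩
  sum₂ at-uv + sum₂ at-vu                                   ≡⟨ cong₂ _+_ (sum₂-ind-== u v) (sum₂-ind-== v u) ⟩
  1 + 1                                                     ∎)
  where
  open ≡-Reasoning
  at-uv at-vu : Fin _ → Fin _ → ℕ
  at-uv i j = ind (i == u) * ind (j == v)
  at-vu i j = ind (i == v) * ind (j == u)
  removed : ∀ i j → ind (proj₁ (joining u v) i j ∧ adj G i j) ≡ at-uv i j + at-vu i j
  removed i j with i ≟ u | i ≟ v
  ... | yes refl | yes refl = ⊥-elim (false≢true (trans (sym (irrefl G i)) uv))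
  ... | yes refl | no _ with j ≟ v
  ...   | yes refl = cong ind uv
  ...   | no _     = refl
  removed i j | no _ | yes refl with j ≟ u
  ...   | yes refl = cong ind (trans (adj-sym G v u) uv)
  ...   | no _     = refl
  removed i j | no _ | no _ = refl

numEdges-isolate : ∀ {n} (G : Graph n) v → numEdges G ≡ numEdges (isolate G v) + degree G v
numEdges-isolate G v = numEdges-removeEdges G (touching v) (degree G v) (begin
  sum₂ (λ i j → ind (proj₁ (touching v) i j ∧ adj G i j))   ≡⟨ sum₂-cong removed ⟩
  sum₂ (λ i j → fromV i j + toV i j)                         ≡⟨ sum₂-distrib-+ fromV toV ⟩
  sum₂ fromV + sum₂ toV                                      ≡⟨ cong₂ _+_ fromV-sum toV-sum ⟩
  degree G v + degree G v                                    ∎)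
  where
  open ≡-Reasoning
  fromV toV : Fin _ → Fin _ → ℕ
  fromV i j = ind (i == v) * ind (adj G v j)
  toV i j = ind (j == v) * ind (adj G i j)
  removed : ∀ i j → ind (proj₁ (touching v) i j ∧ adj G i j) ≡ fromV i j + toV i j
  removed i j with i ≟ v | j ≟ v
  ... | yes refl | yes refl rewrite irrefl G i = refl
  ... | yes refl | no _     = sym (trans (+-identityʳ _) (*-identityˡ _))
  ... | no _     | yes refl = sym (*-identityˡ _)
  ... | no _     | no _     = refl
  fromV-sum : sum₂ fromV ≡ degree G v
  fromV-sum = trans (sym (sum-cong-≗ (λ i → *-distribˡ-sum (ind (i == v)) (ind ∘ adj G v))))
                    (sum-δ v (const (degree G v)))
  toV-sum : sum₂ toV ≡ degree G v
  toV-sum = trans (sum-cong-≗ (λ i → sum-δ v (λ j → ind (adj G i j))))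
                  (sum-cong-≗ (λ i → cong ind (adj-sym G i v)))

isolate-keeps : ∀ {n} (G : Graph n) {v i j} → i ≢ v → j ≢ v →
                adj (isolate G v) i j ≡ adj G i j
isolate-keeps G {v} i≢v j≢v =
  removeEdges-keeps G (touching v) (cong₂ _∨_ (==-≢ i≢v) (==-≢ j≢v))

isolate-≢ : ∀ {n} (G : Graph n) {v i j} → adj (isolate G v) i j ≡ true → i ≢ v
isolate-≢ G {v} {j = j} ij refl =
  false≢true (trans (sym (∧-zeroʳ (adj G v j)))
                    (subst (λ b → adj G v j ∧ not (b ∨ j == v) ≡ true) (==-refl v) ij))

isolate⊆deleteEdge : ∀ {n} (G : Graph n) {v} x → isolate G v ⊆ᴳ deleteEdge G v x
isolate⊆deleteEdge G {v} x i j ij =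
  trans (removeEdges-keeps G (joining v x) not-joining) (removeEdges-⊆ G (touching v) i j ij)
  where
  j≢v : j ≢ v
  j≢v = isolate-≢ G (trans (adj-sym (isolate G v) j i) ij)
  not-joining : proj₁ (joining v x) i j ≡ false
  not-joining rewrite ==-≢ (isolate-≢ G ij) | ==-≢ j≢v = ∧-zeroʳ (i == x)

-- Walks and connected components

walk-++ : ∀ {n} {G : Graph n} {u v w} → Walk G u v → Walk G v w → Walk G u w
walk-++ here       q = q
walk-++ (step e p) q = step e (walk-++ p q)

walk-edge : ∀ {n} {G : Graph n} {u v} → adj G u v ≡ true → Walk G u v
walk-edge e = step e here

walk-reverse : ∀ {n} {G : Graph n} {u v} → Walk G u v → Walk G v u
walk-reverse here = here
walk-reverse {G = G} (step {u} {v} e p) =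
  walk-++ (walk-reverse p) (walk-edge (trans (adj-sym G v u) e))

walk-mono : ∀ {n} {G H : Graph n} → H ⊆ᴳ G → ∀ {u v} → Walk H u v → Walk G u v
walk-mono H⊆G here = here
walk-mono H⊆G (step {u} {v} e p) = step (H⊆G u v e) (walk-mono H⊆G p)

walk-preserves : ∀ {n} {G : Graph n} (P : Fin n → Set) →
                 (∀ w w' → P w → adj G w w' ≡ true → P w') →
                 ∀ {u v} → Walk G u v → P u → P v
walk-preserves P closed here               Pu = Pu
walk-preserves P closed (step {u} {v} e p) Pu = walk-preserves P closed p (closed u v Pu e)

label : ∀ {n c} {G : Graph n} → IsNumComponents G c → Fin n → Fin c
label = proj₁

walk⇒label-≡ : ∀ {n c} {G : Graph n} (comps : IsNumComponents G c) {u v} →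
               Walk G u v → label comps u ≡ label comps v
walk⇒label-≡ (_ , _ , connected) = proj₂ (connected _ _)

label-≡⇒walk : ∀ {n c} {G : Graph n} (comps : IsNumComponents G c) {u v} →
               label comps u ≡ label comps v → Walk G u v
label-≡⇒walk (_ , _ , connected) = proj₁ (connected _ _)

Merged : ∀ {k} → Fin k → Fin k → Fin k → Fin k → Set
Merged p q x y = x ≡ y ⊎ ((x ≡ p ⊎ x ≡ q) × (y ≡ p ⊎ y ≡ q))

Merged-trans : ∀ {k} {p q x y z : Fin k} → Merged p q x y → Merged p q y z → Merged p q x z
Merged-trans (inj₁ refl)      yz              = yz
Merged-trans (inj₂ xy)        (inj₁ refl)     = inj₂ xy
Merged-trans (inj₂ (x∈ , _))  (inj₂ (_ , z∈)) = inj₂ (x∈ , z∈)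

Merged-refl⇒≡ : ∀ {k} {p x y : Fin k} → Merged p p x y → x ≡ y
Merged-refl⇒≡ (inj₁ x≡y)         = x≡y
Merged-refl⇒≡ (inj₂ (x≡p , y≡p)) = trans (≡p x≡p) (sym (≡p y≡p))
  where
  ≡p : ∀ {p z : Fin _} → z ≡ p ⊎ z ≡ p → z ≡ p
  ≡p (inj₁ e) = e
  ≡p (inj₂ e) = e

walk-Merged : ∀ {n k} {G : Graph n} (ℓ : Fin n → Fin k) {p q} →
              (∀ w w' → adj G w w' ≡ true → Merged p q (ℓ w) (ℓ w')) →
              ∀ {u v} → Walk G u v → Merged p q (ℓ u) (ℓ v)
walk-Merged ℓ {p} {q} edge-Merged {u} walk =
  walk-preserves (λ w → Merged p q (ℓ u) (ℓ w))
                 (λ w w' uw ww' → Merged-trans uw (edge-Merged w w' ww')) walk (inj₁ refl)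

surjective-factor⇒≤ : ∀ {n c₁ c₂} (f₁ : Fin n → Fin c₁) (f₂ : Fin n → Fin c₂) →
                      Surjective _≡_ _≡_ f₁ → (∀ r r' → f₂ r ≡ f₂ r' → f₁ r ≡ f₁ r') →
                      c₁ ≤ c₂
surjective-factor⇒≤ {n} {c₁} f₁ f₂ f₁-surj factor =
  FinP.injective⇒≤ {f = f₂ ∘ section} section-injective
  where
  section : Fin c₁ → Fin n
  section l = proj₁ (f₁-surj l)
  section-injective : ∀ {l l'} → f₂ (section l) ≡ f₂ (section l') → l ≡ l'
  section-injective {l} {l'} eq =
    trans (sym (proj₂ (f₁-surj l) refl)) (trans (factor _ _ eq) (proj₂ (f₁-surj l') refl))

Edgeless : ∀ {n} → Graph n → Set
Edgeless G = ∀ i j → adj G i j ≡ false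

edgeless-walk⇒≡ : ∀ {n} {G : Graph n} → Edgeless G → ∀ {u v} → Walk G u v → u ≡ v
edgeless-walk⇒≡ edgeless here = refl
edgeless-walk⇒≡ edgeless (step {u} {v} e _) = ⊥-elim (false≢true (trans (sym (edgeless u v)) e))

edgeless-numComponents : ∀ {n} (G : Graph n) {c} → Edgeless G → IsNumComponents G c → n ≤ c
edgeless-numComponents G edgeless comps =
  surjective-factor⇒≤ (λ i → i) (label comps) (λ i → i , λ i≡ → i≡)
                      (λ r r' eq → edgeless-walk⇒≡ edgeless (label-≡⇒walk comps eq))

-- Off the class q, the G-component determines the H-label.
numComponents-Merged-≤ : ∀ {n} {G H : Graph n} {c c'} → IsNumComponents G c →
  (comps : IsNumComponents H c') (p q : Fin c') →
  (∀ w w' → adj G w w' ≡ true → Merged p q (label comps w) (label comps w')) → c' ≤ suc c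
numComponents-Merged-≤ {n} compsG (ℓ , ℓ-surj , _) p q edge-Merged =
  surjective-factor⇒≤ ℓ split ℓ-surj factor
  where
  split : Fin n → Fin (suc _)
  split r with ℓ r ≟ q
  ... | yes _ = F.zero
  ... | no _  = F.suc (label compsG r)
  factor : ∀ r r' → split r ≡ split r' → ℓ r ≡ ℓ r'
  factor r r' eq with ℓ r ≟ q | ℓ r' ≟ q
  ... | yes r≡q | yes r'≡q = trans r≡q (sym r'≡q)
  factor r r' () | yes _ | no _
  factor r r' () | no _  | yes _
  ... | no r≢q  | no r'≢q
    with walk-Merged ℓ edge-Merged (label-≡⇒walk compsG (FinP.suc-injective eq))
  ...   | inj₁ r≡r'                   = r≡r'
  ...   | inj₂ (inj₁ r≡p , inj₁ r'≡p) = trans r≡p (sym r'≡p)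
  ...   | inj₂ (inj₂ r≡q , _)         = ⊥-elim (r≢q r≡q)
  ...   | inj₂ (_ , inj₂ r'≡q)        = ⊥-elim (r'≢q r'≡q)

deleteEdge-Merged : ∀ {n k} (G : Graph n) {u v} (comps : IsNumComponents (deleteEdge G u v) k) →
                    let ℓ = label comps in
                    ∀ w w' → adj G w w' ≡ true → Merged (ℓ u) (ℓ v) (ℓ w) (ℓ w')
deleteEdge-Merged G {u} {v} comps w w' ww' with proj₁ (joining u v) w w' in joins
... | false =
  inj₁ (walk⇒label-≡ comps (walk-edge (trans (removeEdges-keeps G (joining u v) joins) ww')))
... | true with joining-true {u = u} {v} {w} {w'} joins
...   | inj₁ (refl , refl) = inj₂ (inj₁ refl , inj₂ refl)
...   | inj₂ (refl , refl) = inj₂ (inj₂ refl , inj₁ refl)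

isolate-Merged : ∀ {n k} (G : Graph n) {v x} (comps : IsNumComponents (isolate G v) k) →
                 let ℓ = label comps in
                 (∀ y → adj G v y ≡ true → ℓ y ≡ ℓ x) →
                 ∀ w w' → adj G w w' ≡ true → Merged (ℓ v) (ℓ x) (ℓ w) (ℓ w')
isolate-Merged G {v} comps neighbours w w' ww' with w ≟ v | w' ≟ v
... | yes refl | yes refl = ⊥-elim (false≢true (trans (sym (irrefl G w)) ww'))
... | yes refl | no _     = inj₂ (inj₁ refl , inj₂ (neighbours w' ww'))
... | no _     | yes refl = inj₂ (inj₂ (neighbours w (trans (adj-sym G v w) ww')) , inj₁ refl)
... | no w≢v   | no w'≢v  =
  inj₁ (walk⇒label-≡ comps (walk-edge (trans (isolate-keeps G w≢v w'≢v) ww')))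

module _ {k} {p q : Fin (suc k)} (p≢q : p ≢ q) where

  merge : Fin (suc k) → Fin k
  merge x with x ≟ q
  ... | yes _   = punchOut (p≢q ∘ sym)
  ... | no x≢q  = punchOut (x≢q ∘ sym)

  merge-p≡merge-q : merge p ≡ merge q
  merge-p≡merge-q with p ≟ q | q ≟ q
  ... | yes p≡q | _       = ⊥-elim (p≢q p≡q)
  ... | no _    | yes _   = FinP.punchOut-cong q refl
  ... | no _    | no q≢q  = ⊥-elim (q≢q refl)

  Merged⇒merge-≡ : ∀ {x y} → Merged p q x y → merge x ≡ merge y
  Merged⇒merge-≡ (inj₁ refl) = refl
  Merged⇒merge-≡ (inj₂ (x∈ , y∈)) = trans (to-p x∈) (sym (to-p y∈))
    where
    to-p : ∀ {z} → z ≡ p ⊎ z ≡ q → merge z ≡ merge p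
    to-p (inj₁ refl) = refl
    to-p (inj₂ refl) = sym merge-p≡merge-q

  merge-≡⇒Merged : ∀ x y → merge x ≡ merge y → Merged p q x y
  merge-≡⇒Merged x y eq with x ≟ q | y ≟ q
  ... | yes x≡q | yes y≡q = inj₁ (trans x≡q (sym y≡q))
  ... | yes x≡q | no _    = inj₂ (inj₂ x≡q , inj₁ (sym (FinP.punchOut-injective {i = q} _ _ eq)))
  ... | no _    | yes y≡q = inj₂ (inj₁ (FinP.punchOut-injective {i = q} _ _ eq) , inj₂ y≡q)
  ... | no _    | no _    = inj₁ (FinP.punchOut-injective {i = q} _ _ eq)

  merge-punchIn : ∀ y → merge (punchIn q y) ≡ y
  merge-punchIn y with punchIn q y ≟ q
  ... | yes eq = ⊥-elim (FinP.punchInᵢ≢i q y eq)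
  ... | no _   = trans (FinP.punchOut-cong q refl) (FinP.punchOut-punchIn q)

numComponents-addEdge-inside : ∀ {n c} (G : Graph n) {u v} →
  (comps : IsNumComponents (deleteEdge G u v) c) → label comps u ≡ label comps v →
  IsNumComponents G c
numComponents-addEdge-inside G {u} {v} comps@(ℓ , ℓ-surj , _) ℓu≡ℓv =
  ℓ , ℓ-surj , λ a b →
    walk-mono (removeEdges-⊆ G (joining u v)) ∘ label-≡⇒walk comps
  , λ walk → Merged-refl⇒≡ (subst (λ l → Merged (ℓ u) l (ℓ a) (ℓ b)) (sym ℓu≡ℓv)
                                 (walk-Merged ℓ (deleteEdge-Merged G comps) walk))

numComponents-addEdge-between : ∀ {n k} (G : Graph n) {u v} → adj G u v ≡ true →
  (comps : IsNumComponents (deleteEdge G u v) (suc k)) → label comps u ≢ label comps v →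
  IsNumComponents G k
numComponents-addEdge-between G {u} {v} uv comps@(ℓ , ℓ-surj , _) ℓu≢ℓv =
  merge ℓu≢ℓv ∘ ℓ , merged-surj , λ a b → from-label a b
  , Merged⇒merge-≡ ℓu≢ℓv ∘ walk-Merged ℓ (deleteEdge-Merged G comps)
  where
  merged-surj : Surjective _≡_ _≡_ (merge ℓu≢ℓv ∘ ℓ)
  merged-surj y = proj₁ (ℓ-surj (punchIn (ℓ v) y))
                , λ { refl → trans (cong (merge ℓu≢ℓv) (proj₂ (ℓ-surj (punchIn (ℓ v) y)) refl))
                                   (merge-punchIn ℓu≢ℓv y) }
  walk-G : ∀ {a b} → ℓ a ≡ ℓ b → Walk G a b
  walk-G = walk-mono (removeEdges-⊆ G (joining u v)) ∘ label-≡⇒walk comps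
  walk-to-u : ∀ a → ℓ a ≡ ℓ u ⊎ ℓ a ≡ ℓ v → Walk G a u
  walk-to-u a (inj₁ a~u) = walk-G a~u
  walk-to-u a (inj₂ a~v) = walk-++ (walk-G a~v) (walk-edge (trans (adj-sym G v u) uv))
  from-label : ∀ a b → merge ℓu≢ℓv (ℓ a) ≡ merge ℓu≢ℓv (ℓ b) → Walk G a b
  from-label a b eq with merge-≡⇒Merged ℓu≢ℓv (ℓ a) (ℓ b) eq
  ... | inj₁ a~b       = walk-G a~b
  ... | inj₂ (a∈ , b∈) = walk-++ (walk-to-u a a∈) (walk-reverse (walk-to-u b b∈))

numComponents-addEdge : ∀ {n} (G : Graph n) {u v c} → adj G u v ≡ true →
                        IsNumComponents (deleteEdge G u v) c → ∃ (IsNumComponents G)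
numComponents-addEdge G {u} {c = zero}  uv comps = ⊥-elim (FinP.¬Fin0 (label comps u))
numComponents-addEdge G {u} {v} {suc k} uv comps with label comps u ≟ label comps v
... | yes ℓu≡ℓv = suc k , numComponents-addEdge-inside G comps ℓu≡ℓv
... | no ℓu≢ℓv  = k , numComponents-addEdge-between G uv comps ℓu≢ℓv

numComponents-exists : ∀ {n} (G : Graph n) → ∃ (IsNumComponents G)
numComponents-exists G = go (numEdges G) G ≤-refl
  where
  go : ∀ {n} m (G : Graph n) → numEdges G ≤ m → ∃ (IsNumComponents G)
  go {n} m G E≤m with FinP.any? (λ u → FinP.any? (λ v → adj G u v ≟ᵇ true))
  ... | no no-edge = n , (λ i → i) , (λ i → i , λ i≡ → i≡)
                   , λ u v → (λ { refl → here }) , edgeless-walk⇒≡ edgeless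
    where
    edgeless : Edgeless G
    edgeless u v with adj G u v in uv
    ... | false = refl
    ... | true  = ⊥-elim (no-edge (u , v , uv))
  go (suc m) G E≤m | yes (u , v , uv) =
    numComponents-addEdge G uv (proj₂ (go m (deleteEdge G u v) (≤-pred E'<)))
    where
    E'< : suc (numEdges (deleteEdge G u v)) ≤ suc m
    E'< = subst (_≤ suc m) (trans (numEdges-deleteEdge G uv) (+-comm _ 1)) E≤m
  go zero G E≤0 | yes (u , v , uv) =
    contradiction (m+n≤o⇒n≤o (numEdges (deleteEdge G u v)) {n = 1}
                             (subst (_≤ 0) (numEdges-deleteEdge G uv) E≤0)) λ ()

-- Vertex sets and stable sets

VertexSet : ℕ → Set
VertexSet n = Fin n → Bool

card : ∀ {n} → VertexSet n → ℕ
card S = sum (ind ∘ S)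

∁ : ∀ {n} → VertexSet n → VertexSet n
∁ S = not ∘ S

_⊆_ : ∀ {n} → VertexSet n → VertexSet n → Set
S ⊆ T = ∀ i → S i ≡ true → T i ≡ true

_[_]≔_ : ∀ {n} → VertexSet n → Fin n → Bool → VertexSet n
S [ v ]≔ b = updateAt S v (const b)

[]≔-same : ∀ {n} (S : VertexSet n) v b → (S [ v ]≔ b) v ≡ b
[]≔-same S v b = VecFP.updateAt-updates v S

[]≔-other : ∀ {n} (S : VertexSet n) {v} b {i} → i ≢ v → (S [ v ]≔ b) i ≡ S i
[]≔-other S {v} b {i} i≢v = VecFP.updateAt-minimal i v S i≢v

[]≔-true : ∀ {n} (S : VertexSet n) v b {i} → (S [ v ]≔ b) i ≡ true →
           (i ≡ v × b ≡ true) ⊎ (i ≢ v × S i ≡ true)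
[]≔-true S v b {i} Si with i ≟ v
... | yes refl = inj₁ (refl , trans (sym ([]≔-same S v b)) Si)
... | no i≢v   = inj₂ (i≢v , trans (sym ([]≔-other S b i≢v)) Si)

[]≔false-⊆ : ∀ {n} (S : VertexSet n) v → (S [ v ]≔ false) ⊆ S
[]≔false-⊆ S v i Si with []≔-true S v false Si
... | inj₂ (_ , Si′) = Si′

card-cong : ∀ {n} {S T : VertexSet n} → (∀ i → S i ≡ T i) → card S ≡ card T
card-cong S≗T = sum-cong-≗ (cong ind ∘ S≗T)

card-[]≔ : ∀ {n} (S : VertexSet n) v b → card (S [ v ]≔ b) + ind (S v) ≡ card S + ind b
card-[]≔ S v b =
  trans (sum-update (ind ∘ (S [ v ]≔ b)) (ind ∘ S) v (λ i i≢v → cong ind ([]≔-other S b i≢v)))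
        (cong (λ c → card S + ind c) ([]≔-same S v b))

∁-[]≔ : ∀ {n} (S : VertexSet n) v b i → ∁ (S [ v ]≔ b) i ≡ (∁ S [ v ]≔ not b) i
∁-[]≔ S v b i with i ≟ v
... | yes refl = trans (cong not ([]≔-same S v b)) (sym ([]≔-same (∁ S) v (not b)))
... | no i≢v   = trans (cong not ([]≔-other S b i≢v)) (sym ([]≔-other (∁ S) (not b) i≢v))

card-const-false : ∀ n → card {n} (const false) ≡ 0
card-const-false n = trans (sum-const n 0) (*-zeroʳ n)

card-const-true : ∀ n → card {n} (const true) ≡ n
card-const-true n = trans (sum-const n 1) (*-identityʳ n)

card-pos : ∀ {n} (S : VertexSet n) → 1 ≤ card S → ∃ λ i → S i ≡ true
card-pos {zero}  S ()
card-pos {suc n} S 1≤ with S F.zero in S0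
... | true  = F.zero , S0
... | false with card-pos (S ∘ F.suc) 1≤
...   | i , Si = F.suc i , Si

card-∋ : ∀ {n} (S : VertexSet n) {v} → S v ≡ true → 1 ≤ card S
card-∋ S {v} Sv = ≤-trans (≤-reflexive (cong ind (sym Sv))) (≤-sum (ind ∘ S) v)

card-insert : ∀ {n} (S : VertexSet n) {v} → S v ≡ false → card (S [ v ]≔ true) ≡ card S + 1
card-insert S {v} Sv = trans (sym (+-identityʳ _))
  (subst (λ b → card (S [ v ]≔ true) + ind b ≡ card S + 1) Sv (card-[]≔ S v true))

card-remove : ∀ {n} (S : VertexSet n) {v} → S v ≡ true → card (S [ v ]≔ false) + 1 ≡ card S
card-remove S {v} Sv = trans
  (subst (λ b → card (S [ v ]≔ false) + ind b ≡ card S + 0) Sv (card-[]≔ S v false)) (+-identityʳ _)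

card-≤-remove : ∀ {n} (S : VertexSet n) v → card S ≤ card (S [ v ]≔ false) + 1
card-≤-remove S v = begin
  card S                                ≡⟨ +-identityʳ (card S) ⟨
  card S + ind false                    ≡⟨ card-[]≔ S v false ⟨
  card (S [ v ]≔ false) + ind (S v)     ≤⟨ +-monoʳ-≤ _ (ind≤1 (S v)) ⟩
  card (S [ v ]≔ false) + 1             ∎
  where
  open ≤-Reasoning
  ind≤1 : ∀ b → ind b ≤ 1
  ind≤1 true  = ≤-refl
  ind≤1 false = z≤n

card-[]≔false-≥ : ∀ {n} (S : VertexSet n) v {a} → suc a ≤ card S → a ≤ card (S [ v ]≔ false)
card-[]≔false-≥ S v a<S =
  ≤-pred (≤-trans a<S (≤-trans (card-≤-remove S v) (≤-reflexive (+-comm _ 1))))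

card-mono-⊆ : ∀ {n} {S T : VertexSet n} → S ⊆ T → card S ≤ card T
card-mono-⊆ {S = S} {T} S⊆T = sum-mono-≤ pointwise
  where
  pointwise : ∀ i → ind (S i) ≤ ind (T i)
  pointwise i with S i in Si
  ... | false = z≤n
  ... | true  = ≤-reflexive (cong ind (sym (S⊆T i Si)))

⊆-trans : ∀ {n} {S T U : VertexSet n} → S ⊆ T → T ⊆ U → S ⊆ U
⊆-trans S⊆T T⊆U i Si = T⊆U i (S⊆T i Si)

⊆-[]≔false : ∀ {n} {S L : VertexSet n} v → S ⊆ L → (S [ v ]≔ false) ⊆ (L [ v ]≔ false)
⊆-[]≔false {S = S} {L} v S⊆L i S′i with []≔-true S v false S′i
... | inj₂ (i≢v , Si) = trans ([]≔-other L false i≢v) (S⊆L i Si)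

⊆-[]≔false⇒∉ : ∀ {n} {S L : VertexSet n} v → S ⊆ (L [ v ]≔ false) → S v ≡ false
⊆-[]≔false⇒∉ {S = S} {L} v S⊆L′ with S v in Sv
... | false = refl
... | true  = ⊥-elim (false≢true (trans (sym ([]≔-same L v false)) (S⊆L′ v Sv)))

card-∁-[]≔false : ∀ {n} (L : VertexSet n) {v} → L v ≡ true →
              card (∁ (L [ v ]≔ false)) ≡ card (∁ L) + 1
card-∁-[]≔false L {v} Lv = trans (card-cong (∁-[]≔ L v false)) (card-insert (∁ L) (cong not Lv))

singleton : ∀ {n} → Fin n → VertexSet n
singleton v = const false [ v ]≔ true

card-singleton : ∀ {n} (v : Fin n) → card (singleton v) ≡ 1
card-singleton {n} v = trans (card-insert (const false) {v} refl) (cong (_+ 1) (card-const-false n))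

Stable : ∀ {n} → Graph n → VertexSet n → Set
Stable G S = ∀ i j → S i ≡ true → S j ≡ true → adj G i j ≡ false

Stable-⊆ : ∀ {n} {G : Graph n} {S T} → T ⊆ S → Stable G S → Stable G T
Stable-⊆ T⊆S S-stable i j Ti Tj = S-stable i j (T⊆S i Ti) (T⊆S j Tj)

Stable-⊆ᴳ : ∀ {n} {G H : Graph n} {S} → H ⊆ᴳ G → Stable G S → Stable H S
Stable-⊆ᴳ {H = H} H⊆G S-stable i j Si Sj with adj H i j in Hij
... | false = refl
... | true  = ⊥-elim (false≢true (trans (sym (S-stable i j Si Sj)) (H⊆G i j Hij)))

Stable-[]≔ : ∀ {n} {G : Graph n} {S} v {b} → Stable G S →
             (b ≡ true → ∀ s → S s ≡ true → adj G v s ≡ false) → Stable G (S [ v ]≔ b)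
Stable-[]≔ {G = G} {S} v {b} S-stable v-free i j S′i S′j
  with []≔-true S v b S′i | []≔-true S v b S′j
... | inj₁ (refl , _)  | inj₁ (refl , _)  = irrefl G v
... | inj₁ (refl , b≡) | inj₂ (_ , Sj)    = v-free b≡ j Sj
... | inj₂ (_ , Si)    | inj₁ (refl , b≡) = trans (adj-sym G i v) (v-free b≡ i Si)
... | inj₂ (_ , Si)    | inj₂ (_ , Sj)    = S-stable i j Si Sj

Stable-isolate : ∀ {n} (G : Graph n) {v S} → S v ≡ false → Stable (isolate G v) S → Stable G S
Stable-isolate G {v} {S} Sv S-stable i j Si Sj =
  trans (sym (isolate-keeps G (∉S Si) (∉S Sj))) (S-stable i j Si Sj)
  where
  ∉S : ∀ {w} → S w ≡ true → w ≢ v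
  ∉S Sw refl = false≢true (trans (sym Sv) Sw)

singleton-stable : ∀ {n} (G : Graph n) v → Stable G (singleton v)
singleton-stable G v = Stable-[]≔ {G = G} v (λ _ _ ()) (λ _ _ ())

singleton-⊆ : ∀ {n} {L : VertexSet n} {v} → L v ≡ true → singleton v ⊆ L
singleton-⊆ {v = v} Lv i Si with []≔-true (const false) v true Si
... | inj₁ (refl , _) = Lv

StabilityBound : ∀ {n} → Graph n → VertexSet n → ℕ → Set
StabilityBound G L a = ∀ S → Stable G S → S ⊆ L → card S ≤ a

StableOfSize : ∀ {n} → Graph n → VertexSet n → ℕ → Set
StableOfSize G L a = Σ (VertexSet _) λ S → Stable G S × S ⊆ L × a ≤ card S

StableOfSize-cong : ∀ {n} {G : Graph n} {L a S T} → (∀ i → S i ≡ T i) →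
                    Stable G S × S ⊆ L × a ≤ card S → Stable G T × T ⊆ L × a ≤ card T
StableOfSize-cong S≗T (S-stable , S⊆L , a≤S) =
  (λ i j Ti Tj → S-stable i j (trans (S≗T i) Ti) (trans (S≗T j) Tj)) ,
  (λ i Ti → S⊆L i (trans (S≗T i) Ti)) ,
  ≤-trans a≤S (≤-reflexive (card-cong S≗T))

Stable? : ∀ {n} (G : Graph n) S → Dec (Stable G S)
Stable? G S = FinP.all? λ i → FinP.all? λ j →
  (S i ≟ᵇ true) →-dec (S j ≟ᵇ true) →-dec (adj G i j ≟ᵇ false)

_⊆?_ : ∀ {n} (S T : VertexSet n) → Dec (S ⊆ T)
S ⊆? T = FinP.all? λ i → (S i ≟ᵇ true) →-dec (T i ≟ᵇ true)

StableOfSize? : ∀ {n} (G : Graph n) L a → Dec (StableOfSize G L a)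
StableOfSize? G L a
  with SubsetP.anySubset? (λ p → let S = Vec.lookup p in
         Stable? G S ×-dec S ⊆? L ×-dec a ≤? card S)
... | yes (p , large) = yes (Vec.lookup p , large)
... | no none = no λ (S , large) → none (Vec.tabulate S ,
  StableOfSize-cong {G = G} {L} {a} {S} (λ i → sym (VecP.lookup∘tabulate S i)) large)

¬StableOfSize⇒StabilityBound : ∀ {n} {G : Graph n} {L a} →
                               ¬ StableOfSize G L (suc a) → StabilityBound G L a
¬StableOfSize⇒StabilityBound {a = a} none S S-stable S⊆L with card S ≤? a
... | yes S≤a = S≤a
... | no S≰a  = ⊥-elim (none (S , S-stable , S⊆L , ≰⇒> S≰a))

Dominates : ∀ {n} → Graph n → VertexSet n → VertexSet n → Set
Dominates G S L =
  ∀ u → L u ≡ true → S u ≡ false → ∃ λ s → S s ≡ true × adj G s u ≡ true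

maximum-stable-dominates : ∀ {n} {G : Graph n} {S L} → Stable G S → S ⊆ L →
                           StabilityBound G L (card S) → Dominates G S L
maximum-stable-dominates {G = G} {S} {L} S-stable S⊆L maximum u Lu Su
  with FinP.any? (λ s → (S s ≟ᵇ true) ×-dec (adj G s u ≟ᵇ true))
... | yes dominated = dominated
... | no undominated = ⊥-elim (1+n≰n (begin
  suc (card S)           ≡⟨ +-comm 1 (card S) ⟩
  card S + 1             ≡⟨ card-insert S Su ⟨
  card (S [ u ]≔ true)   ≤⟨ maximum _ S′-stable S′⊆L ⟩
  card S                 ∎))
  where
  open ≤-Reasoning
  u-free : ∀ s → S s ≡ true → adj G u s ≡ false
  u-free s Ss with adj G s u in su | adj-sym G s u
  ... | true  | _    = ⊥-elim (undominated (s , Ss , su))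
  ... | false | us≡  = sym us≡
  S′-stable : Stable G (S [ u ]≔ true)
  S′-stable = Stable-[]≔ {G = G} u S-stable (λ _ → u-free)
  S′⊆L : (S [ u ]≔ true) ⊆ L
  S′⊆L i S′i with []≔-true S u true S′i
  ... | inj₁ (refl , _) = Lu
  ... | inj₂ (_ , Si)   = S⊆L i Si

card-≤-dominating : ∀ {n} (G : Graph n) {S L} Δ → (∀ s → degree G s ≤ Δ) →
                    Dominates G S L → card L ≤ card S * suc Δ
card-≤-dominating G {S} {L} Δ deg≤Δ dominates = begin
  card L
    ≤⟨ sum-mono-≤ covered ⟩
  sum (λ u → ind (S u) + sum (λ s → hit s u))
    ≡⟨ ∑-distrib-+ (ind ∘ S) (λ u → sum (λ s → hit s u)) ⟩
  card S + sum₂ (λ u s → hit s u)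
    ≡⟨ cong (card S +_) (∑-comm (λ u s → hit s u)) ⟩
  card S + sum₂ hit
    ≡⟨ cong (card S +_) (sum-cong-≗ (λ s → *-distribˡ-sum (ind (S s)) (ind ∘ adj G s))) ⟨
  card S + sum (λ s → ind (S s) * degree G s)
    ≤⟨ +-monoʳ-≤ (card S) (sum-mono-≤ (λ s → *-monoʳ-≤ (ind (S s)) (deg≤Δ s))) ⟩
  card S + sum (λ s → ind (S s) * Δ)
    ≡⟨ cong (card S +_) (*-distribʳ-sum Δ (ind ∘ S)) ⟨
  card S + card S * Δ
    ≡⟨ *-suc (card S) Δ ⟨
  card S * suc Δ ∎
  where
  open ≤-Reasoning
  hit : Fin _ → Fin _ → ℕ
  hit s u = ind (S s) * ind (adj G s u)
  covered : ∀ u → ind (L u) ≤ ind (S u) + sum (λ s → hit s u)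
  covered u with L u in Lu | S u in Su
  ... | false | _    = z≤n
  ... | true  | true = s≤s z≤n
  ... | true  | false with dominates u Lu Su
  ...   | s , Ss , su =
    ≤-trans (≤-reflexive (cong₂ (λ b c → ind b * ind c) (sym Ss) (sym su))) (≤-sum (λ s → hit s u) s)

argmax-degree : ∀ {n} (G : Graph n) → Fin n → Σ (Fin n) λ v → ∀ i → degree G i ≤ degree G v
argmax-degree {n} G w = argmax (degree G) w (allFin n)
                      , λ i → All.lookup (f[xs]≤f[argmax] {f = degree G} w (allFin n)) (∈-allFin i)

max-degree-neighbour : ∀ {n} (G : Graph n) {v w j} → adj G w j ≡ true →
                       (∀ i → degree G i ≤ degree G v) → ∃ λ x → adj G v x ≡ true
max-degree-neighbour G {v} {w} wj maximal =
  card-pos (adj G v) (≤-trans (card-∋ (adj G w) wj) (maximal w))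

-- The exchange argument

Closed : ∀ {n} → Graph n → VertexSet n → Set
Closed H A = ∀ i j → adj H i j ≡ true → A i ≡ true → A j ≡ true

splice : ∀ {n} → VertexSet n → VertexSet n → VertexSet n → VertexSet n
splice A U W i = if A i then U i else W i

Stable-splice : ∀ {n} {H : Graph n} {A U W} → Closed H A →
                Stable H U → Stable H W → Stable H (splice A U W)
Stable-splice {H = H} {A} {U} {W} A-closed U-stable W-stable i j S′i S′j
  with adj H i j in ij
... | false = refl
... | true with A i in Ai | A j in Aj
...   | true  | true  = trans (sym ij) (U-stable i j S′i S′j)
...   | false | false = trans (sym ij) (W-stable i j S′i S′j)
...   | true  | false = ⊥-elim (false≢true (trans (sym Aj) (A-closed i j ij Ai)))
...   | false | true  = ⊥-elim (false≢true (trans (sym Ai) (A-closed j i (trans (adj-sym H j i) ij) Aj)))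

ind-splice : ∀ {n} (A U W : VertexSet n) i →
             ind (U i) + ind (W i) ≡ ind (splice A U W i) + ind (splice A W U i)
ind-splice A U W i with A i
... | true  = refl
... | false = +-comm (ind (U i)) (ind (W i))

card-splice : ∀ {n} (A U W : VertexSet n) →
              card U + card W ≡ card (splice A U W) + card (splice A W U)
card-splice A U W = begin
  card U + card W
    ≡⟨ ∑-distrib-+ (ind ∘ U) (ind ∘ W) ⟨
  sum (λ i → ind (U i) + ind (W i))
    ≡⟨ sum-cong-≗ (ind-splice A U W) ⟩
  sum (λ i → ind (splice A U W i) + ind (splice A W U i))
    ≡⟨ ∑-distrib-+ (ind ∘ splice A U W) (ind ∘ splice A W U) ⟩
  card (splice A U W) + card (splice A W U) ∎
  where open ≡-Reasoning

splice-⊆ : ∀ {n} (A : VertexSet n) {U W L} → U ⊆ L → W ⊆ L → splice A U W ⊆ L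
splice-⊆ A U⊆L W⊆L i Si with A i
... | true  = U⊆L i Si
... | false = W⊆L i Si

ind-∧-+1 : ∀ b c → ind b + ind c ≤ ind (b ∧ c) + 1
ind-∧-+1 true  c     = ≤-reflexive (+-comm 1 (ind c))
ind-∧-+1 false true  = ≤-refl
ind-∧-+1 false false = z≤n

module Exchange {n} (G : Graph n) {L v x y c} {T₁ T₂ : VertexSet n}
                (T₁-stable : Stable (deleteEdge G v x) T₁) (T₂-stable : Stable (deleteEdge G v y) T₂)
                (T₁⊆L : T₁ ⊆ L) (T₂⊆L : T₂ ⊆ L) (comps : IsNumComponents (isolate G v) c)
                (ℓx≢ℓy : label comps x ≢ label comps y) where

  private
    Gv = isolate G v
    ℓ = label comps

    A : VertexSet n
    A w = ℓ x == ℓ w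

    A-closed : Closed Gv A
    A-closed w w' ww' Aw =
      ≡⇒== (trans (==⇒≡ {i = ℓ x} {ℓ w} Aw) (walk⇒label-≡ comps (walk-edge ww')))

    T₁-stable′ : Stable Gv T₁
    T₁-stable′ = Stable-⊆ᴳ {G = deleteEdge G v x} {Gv} (isolate⊆deleteEdge G x) T₁-stable

    T₂-stable′ : Stable Gv T₂
    T₂-stable′ = Stable-⊆ᴳ {G = deleteEdge G v y} {Gv} (isolate⊆deleteEdge G y) T₂-stable

    S₁ S₂ : VertexSet n
    S₁ = splice A T₁ T₂
    S₂ = splice A T₂ T₁

    without-v : ∀ {S} → Stable Gv S → Stable G (S [ v ]≔ false)
    without-v {S} S-stable =
      Stable-isolate G ([]≔-same S v false) (Stable-⊆ {G = Gv} ([]≔false-⊆ S v) S-stable)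

  exchangeP exchangeQ : VertexSet n
  exchangeP = S₁ [ v ]≔ false
  exchangeQ = (S₂ [ v ]≔ false) [ v ]≔ (T₁ v ∧ T₂ v)

  exchangeP-stable : Stable G exchangeP
  exchangeP-stable =
    without-v (Stable-splice {H = Gv} {A} {T₁} {T₂} A-closed T₁-stable′ T₂-stable′)

  -- A neighbour of v in S₂ would be in T₂ and differ from y (inside A), or in T₁ and differ from x.
  exchangeQ-stable : Stable G exchangeQ
  exchangeQ-stable = Stable-[]≔ {G = G} v
    (without-v (Stable-splice {H = Gv} {A} {T₂} {T₁} A-closed T₂-stable′ T₁-stable′)) v-free
    where
    v-free : T₁ v ∧ T₂ v ≡ true → ∀ s → (S₂ [ v ]≔ false) s ≡ true → adj G v s ≡ false
    v-free both s S₂′s with []≔-true S₂ v false S₂′s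
    ... | inj₂ (s≢v , S₂s) with A s in As
    ...   | true  = trans (sym (removeEdges-keeps G (joining v y) (joining-outside {w = v} s≢v s≢y)))
                          (T₂-stable v s (∧-conicalʳ (T₁ v) _ both) S₂s)
      where
      s≢y : s ≢ y
      s≢y refl = ℓx≢ℓy (==⇒≡ {i = ℓ x} {ℓ y} As)
    ...   | false = trans (sym (removeEdges-keeps G (joining v x) (joining-outside {w = v} s≢v s≢x)))
                          (T₁-stable v s (∧-conicalˡ (T₁ v) _ both) S₂s)
      where
      s≢x : s ≢ x
      s≢x refl = false≢true (trans (sym As) (==-refl (ℓ s)))

  exchangeP-⊆ : exchangeP ⊆ L
  exchangeP-⊆ i Pi = splice-⊆ A T₁⊆L T₂⊆L i ([]≔false-⊆ S₁ v i Pi)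

  exchangeQ-⊆ : exchangeQ ⊆ L
  exchangeQ-⊆ i Qi with []≔-true (S₂ [ v ]≔ false) v (T₁ v ∧ T₂ v) Qi
  ... | inj₁ (refl , both) = T₁⊆L v (∧-conicalˡ (T₁ v) _ both)
  ... | inj₂ (_ , S₂′i)    = splice-⊆ A T₂⊆L T₁⊆L i ([]≔false-⊆ S₂ v i S₂′i)

  card-exchange : card T₁ + card T₂ ≤ card exchangeP + card exchangeQ + 1
  card-exchange = begin
    card T₁ + card T₂
      ≡⟨ card-splice A T₁ T₂ ⟩
    card S₁ + card S₂
      ≡⟨ cong₂ _+_ (removed S₁) (removed S₂) ⟨
    (card P + ind (S₁ v)) + (card Q′ + ind (S₂ v))
      ≡⟨ interchange (card P) _ _ _ ⟩
    (card P + card Q′) + (ind (S₁ v) + ind (S₂ v))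
      ≡⟨ cong (card P + card Q′ +_) (ind-splice A T₁ T₂ v) ⟨
    (card P + card Q′) + (ind (T₁ v) + ind (T₂ v))
      ≤⟨ +-monoʳ-≤ (card P + card Q′) (ind-∧-+1 (T₁ v) (T₂ v)) ⟩
    (card P + card Q′) + (ind (T₁ v ∧ T₂ v) + 1)
      ≡⟨ regroup (card P) _ _ ⟩
    card P + (card Q′ + ind (T₁ v ∧ T₂ v)) + 1
      ≡⟨ cong (λ q → card P + q + 1) card-Q ⟨
    card P + card exchangeQ + 1 ∎
    where
    open ≤-Reasoning
    P = exchangeP
    Q′ = S₂ [ v ]≔ false
    removed : ∀ S → card (S [ v ]≔ false) + ind (S v) ≡ card S
    removed S = trans (card-[]≔ S v false) (+-identityʳ (card S))
    card-Q : card exchangeQ ≡ card Q′ + ind (T₁ v ∧ T₂ v)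
    card-Q = trans (sym (+-identityʳ _))
                   (subst (λ b → card exchangeQ + ind b ≡ card Q′ + ind (T₁ v ∧ T₂ v))
                          ([]≔-same S₂ v false) (card-[]≔ Q′ v (T₁ v ∧ T₂ v)))
    interchange : ∀ p s q t → (p + s) + (q + t) ≡ (p + q) + (s + t)
    interchange = solve-∀
    regroup : ∀ p q b → (p + q) + (b + 1) ≡ p + (q + b) + 1
    regroup = solve-∀

critical-neighbours-connected : ∀ {n} (G : Graph n) {L a v x y c} → StabilityBound G L a →
  StableOfSize (deleteEdge G v x) L (suc a) → StableOfSize (deleteEdge G v y) L (suc a) →
  (comps : IsNumComponents (isolate G v) c) → label comps x ≡ label comps y
critical-neighbours-connected G {a = a} {x = x} {y} bounded
  (T₁ , T₁-stable , T₁⊆L , T₁-large) (T₂ , T₂-stable , T₂⊆L , T₂-large) comps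
  with label comps x ≟ label comps y
... | yes ℓx≡ℓy = ℓx≡ℓy
... | no ℓx≢ℓy = ⊥-elim (1+n≰n (begin
  suc (a + a + 1)                      ≡⟨ double-suc a ⟩
  suc a + suc a                        ≤⟨ +-mono-≤ T₁-large T₂-large ⟩
  card T₁ + card T₂                    ≤⟨ card-exchange ⟩
  card exchangeP + card exchangeQ + 1  ≤⟨ +-monoˡ-≤ 1 (+-mono-≤ P≤a Q≤a) ⟩
  a + a + 1                            ∎))
  where
  open ≤-Reasoning
  open Exchange G T₁-stable T₂-stable T₁⊆L T₂⊆L comps ℓx≢ℓy
  P≤a : card exchangeP ≤ a
  P≤a = bounded exchangeP exchangeP-stable exchangeP-⊆
  Q≤a : card exchangeQ ≤ a
  Q≤a = bounded exchangeQ exchangeQ-stable exchangeQ-⊆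
  double-suc : ∀ a → suc (a + a + 1) ≡ suc a + suc a
  double-suc = solve-∀

-- The induction

record Hypotheses {n} (G : Graph n) (L : VertexSet n) (a c : ℕ) : Set where
  field
    outside-isolated : ∀ i j → adj G i j ≡ true → L i ≡ true
    attained         : StableOfSize G L a
    bounded          : StabilityBound G L a
    components       : IsNumComponents G c

EdgeBound : ∀ {n} → Graph n → VertexSet n → ℕ → ℕ → Set
EdgeBound G L a c = Σ (Fin a → ℕ) λ z →
  sum z ≡ card L × a + sum (λ i → z i C 2) + card (∁ L) ≤ numEdges G + c

EdgeBoundBelow : ℕ → Set
EdgeBoundBelow m = ∀ {n} (G : Graph n) L a {c} → numEdges G + card L ≤ m →
                   Hypotheses G L a c → EdgeBound G L a c

edgeBound-nothing-live : ∀ {n} (G : Graph n) {L a c} → (∀ i → L i ≡ false) →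
                         Hypotheses G L a c → EdgeBound G L a c
edgeBound-nothing-live {n} G {L} {a} {c} dead hyp = go a≡0
  where
  open Hypotheses hyp
  card-L : card L ≡ 0
  card-L = trans (card-cong dead) (card-const-false n)
  card-∁L : card (∁ L) ≡ n
  card-∁L = trans (card-cong (cong not ∘ dead)) (card-const-true n)
  a≡0 : a ≡ 0
  a≡0 = let (S , _ , S⊆L , a≤S) = attained in
        n≤0⇒n≡0 (≤-trans a≤S (≤-trans (card-mono-⊆ S⊆L) (≤-reflexive card-L)))
  edgeless : Edgeless G
  edgeless i j with adj G i j in ij
  ... | false = refl
  ... | true  = ⊥-elim (false≢true (trans (sym (dead i)) (outside-isolated i j ij)))
  go : a ≡ 0 → EdgeBound G L a c
  go refl = (λ ()) , sym card-L
          , ≤-trans (≤-reflexive card-∁L)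
                    (≤-trans (edgeless-numComponents G edgeless components) (m≤n+m c _))

hypotheses-isolated-vertex : ∀ {n} (G : Graph n) {L a c v} → Hypotheses G L (suc a) c →
  L v ≡ true → (∀ j → adj G v j ≡ false) → Hypotheses G (L [ v ]≔ false) a c
hypotheses-isolated-vertex G {L} {a} {v = v} hyp Lv isolated = record
  { outside-isolated = λ i j ij → trans ([]≔-other L false (≢v j ij)) (outside-isolated i j ij)
  ; attained         = let (S , S-stable , S⊆L , a<S) = attained in
                       S [ v ]≔ false , Stable-⊆ {G = G} ([]≔false-⊆ S v) S-stable
                     , ⊆-[]≔false v S⊆L , card-[]≔false-≥ S v a<S
  ; bounded          = λ S S-stable S⊆L′ → ≤-pred (begin
      suc (card S)          ≡⟨ +-comm 1 (card S) ⟩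
      card S + 1            ≡⟨ card-insert S (⊆-[]≔false⇒∉ v S⊆L′) ⟨
      card (S [ v ]≔ true)  ≤⟨ bounded _ (Stable-[]≔ {G = G} v S-stable (λ _ s _ → isolated s))
                                         (insert-⊆ S⊆L′) ⟩
      suc a                 ∎)
  ; components       = components
  }
  where
  open Hypotheses hyp
  open ≤-Reasoning
  ≢v : ∀ {i} j → adj G i j ≡ true → i ≢ v
  ≢v j ij refl = false≢true (trans (sym (isolated j)) ij)
  insert-⊆ : ∀ {S} → S ⊆ (L [ v ]≔ false) → (S [ v ]≔ true) ⊆ L
  insert-⊆ {S} S⊆L′ i S′i with []≔-true S v true S′i
  ... | inj₁ (refl , _) = Lv
  ... | inj₂ (_ , Si)   = []≔false-⊆ L v i (S⊆L′ i Si)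

edgeBound-isolated-vertex : ∀ {m n} → EdgeBoundBelow m → (G : Graph n) → ∀ {L a c v} →
  numEdges G + card L ≤ suc m → Hypotheses G L a c →
  L v ≡ true → (∀ j → adj G v j ≡ false) → EdgeBound G L a c
edgeBound-isolated-vertex rec G {a = zero} {v = v} _ hyp Lv _ =
  ⊥-elim (1+n≰n (≤-trans (≤-reflexive (sym (card-singleton v)))
                         (Hypotheses.bounded hyp (singleton v) (singleton-stable G v) (singleton-⊆ Lv))))
edgeBound-isolated-vertex {m} rec G {L} {suc a} {v = v} size hyp Lv isolated =
  let (z , size-z , bound-z) = rec G L′ a size′ (hypotheses-isolated-vertex G hyp Lv isolated) in
  (1 ∷ z) , trans (+-comm 1 _) (trans (cong (_+ 1) size-z) (card-remove L Lv))
          , ≤-trans (≤-reflexive (suc-+ʳ _ (sym (card-∁-[]≔false L Lv)))) bound-z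
  where
  L′ = L [ v ]≔ false
  size′ : numEdges G + card L′ ≤ m
  size′ = ≤-pred (≤-trans (≤-reflexive (suc-+ʳ (numEdges G) (card-remove L Lv))) size)

hypotheses-deleteEdge : ∀ {n} (G : Graph n) {L a c c′ u v} → Hypotheses G L a c →
  ¬ StableOfSize (deleteEdge G u v) L (suc a) → IsNumComponents (deleteEdge G u v) c′ →
  Hypotheses (deleteEdge G u v) L a c′
hypotheses-deleteEdge G {u = u} {v} hyp noncritical comps = record
  { outside-isolated = λ i j ij → outside-isolated i j (G′⊆G i j ij)
  ; attained         = let (S , S-stable , rest) = attained in
                       S , Stable-⊆ᴳ {G = G} {deleteEdge G u v} G′⊆G S-stable , rest
  ; bounded          = ¬StableOfSize⇒StabilityBound {G = deleteEdge G u v} noncritical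
  ; components       = comps
  }
  where
  open Hypotheses hyp
  G′⊆G = removeEdges-⊆ G (joining u v)

edgeBound-noncritical-edge : ∀ {m n} → EdgeBoundBelow m → (G : Graph n) → ∀ {L a c u v} →
  numEdges G + card L ≤ suc m → Hypotheses G L a c →
  adj G u v ≡ true → ¬ StableOfSize (deleteEdge G u v) L (suc a) → EdgeBound G L a c
edgeBound-noncritical-edge {m} rec G {L} {a} {c} {u} {v} size hyp uv noncritical =
  let (z , size-z , bound-z) = rec G′ L a size′ (hypotheses-deleteEdge G hyp noncritical (proj₂ comps′)) in
  z , size-z , ≤-trans bound-z (begin
    numEdges G′ + c′       ≤⟨ +-monoʳ-≤ (numEdges G′) c′≤ ⟩
    numEdges G′ + suc c    ≡⟨ suc-+ʳ (numEdges G′) (+-comm c 1) ⟨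
    suc (numEdges G′ + c)  ≡⟨ cong (_+ c) (trans (+-comm 1 _) (sym E≡)) ⟩
    numEdges G + c         ∎)
  where
  open ≤-Reasoning
  G′ = deleteEdge G u v
  E≡ : numEdges G ≡ numEdges G′ + 1
  E≡ = numEdges-deleteEdge G uv
  comps′ : ∃ (IsNumComponents G′)
  comps′ = numComponents-exists G′
  c′ = proj₁ comps′
  c′≤ : c′ ≤ suc c
  c′≤ = numComponents-Merged-≤ {G = G} {G′} (Hypotheses.components hyp) (proj₂ comps′) _ _
                               (deleteEdge-Merged G (proj₂ comps′))
  size′ : numEdges G′ + card L ≤ m
  size′ = ≤-pred (≤-trans (≤-reflexive (cong (_+ card L) (trans (+-comm 1 _) (sym E≡)))) size)

hypotheses-isolate : ∀ {n} (G : Graph n) {L a c cᵥ v x} → Hypotheses G L a c →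
  StableOfSize (deleteEdge G v x) L (suc a) → IsNumComponents (isolate G v) cᵥ →
  Hypotheses (isolate G v) (L [ v ]≔ false) a cᵥ
hypotheses-isolate G {L} {v = v} {x = x} hyp (T , T-stable , T⊆L , a<T) comps = record
  { outside-isolated = λ i j ij → trans ([]≔-other L false (isolate-≢ G ij))
                                        (outside-isolated i j (removeEdges-⊆ G (touching v) i j ij))
  ; attained         = T [ v ]≔ false
                     , Stable-⊆ {G = Gv} ([]≔false-⊆ T v)
                                (Stable-⊆ᴳ {G = deleteEdge G v x} {Gv} (isolate⊆deleteEdge G x) T-stable)
                     , ⊆-[]≔false v T⊆L , card-[]≔false-≥ T v a<T
  ; bounded          = λ S S-stable S⊆L′ →
      bounded S (Stable-isolate G (⊆-[]≔false⇒∉ v S⊆L′) S-stable)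
                (⊆-trans S⊆L′ ([]≔false-⊆ L v))
  ; components       = comps
  }
  where
  open Hypotheses hyp
  Gv = isolate G v

card-≤-stability*degree : ∀ {n} (G : Graph n) {L a c} Δ → Hypotheses G L a c →
                          (∀ s → degree G s ≤ Δ) → card L ≤ a * suc Δ
card-≤-stability*degree G {L} {a} Δ hyp deg≤Δ with Hypotheses.attained hyp
... | S , S-stable , S⊆L , a≤S =
  ≤-trans (card-≤-dominating G Δ deg≤Δ (maximum-stable-dominates {G = G} S-stable S⊆L maximum))
          (*-monoˡ-≤ (suc Δ) (bounded S S-stable S⊆L))
  where
  open Hypotheses hyp
  maximum : StabilityBound G L (card S)
  maximum T T-stable T⊆L = ≤-trans (bounded T T-stable T⊆L) a≤S

edgeBound-all-critical : ∀ {m n} → EdgeBoundBelow m → (G : Graph n) → ∀ {L a c w} →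
  numEdges G + card L ≤ suc m → Hypotheses G L a c → L w ≡ true →
  (∀ v → L v ≡ true → ∃ λ j → adj G v j ≡ true) →
  (∀ u v → adj G u v ≡ true → StableOfSize (deleteEdge G u v) L (suc a)) → EdgeBound G L a c
edgeBound-all-critical {m} rec G {L} {a} {c} {w} size hyp Lw no-isolated critical =
  z⁺ , trans size-z⁺ (trans (+-comm 1 _) size-z+1) , bound-z⁺
  where
  open Hypotheses hyp
  v = proj₁ (argmax-degree G w)
  Δ = degree G v
  Δ-max : ∀ i → degree G i ≤ Δ
  Δ-max = proj₂ (argmax-degree G w)
  neighbour : ∃ λ x → adj G v x ≡ true
  neighbour = max-degree-neighbour G (proj₂ (no-isolated w Lw)) Δ-max
  x = proj₁ neighbour
  Lv : L v ≡ true
  Lv = outside-isolated v x (proj₂ neighbour)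
  Gv = isolate G v
  L′ = L [ v ]≔ false
  E≡ : numEdges G ≡ numEdges Gv + Δ
  E≡ = numEdges-isolate G v
  compsᵥ : ∃ (IsNumComponents Gv)
  compsᵥ = numComponents-exists Gv
  cᵥ = proj₁ compsᵥ
  cᵥ≤ : cᵥ ≤ suc c
  cᵥ≤ = numComponents-Merged-≤ {G = G} {Gv} components (proj₂ compsᵥ) _ _
          (isolate-Merged G (proj₂ compsᵥ) λ y vy →
            critical-neighbours-connected G bounded (critical v y vy) (critical v x (proj₂ neighbour))
                                          (proj₂ compsᵥ))
  size′ : numEdges Gv + card L′ ≤ m
  size′ = ≤-pred (begin
    suc (numEdges Gv + card L′)  ≡⟨ suc-+ʳ (numEdges Gv) (card-remove L Lv) ⟩
    numEdges Gv + card L         ≤⟨ +-monoˡ-≤ (card L) (m≤m+n _ Δ) ⟩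
    numEdges Gv + Δ + card L     ≡⟨ cong (_+ card L) E≡ ⟨
    numEdges G + card L          ≤⟨ size ⟩
    suc m                        ∎)
    where open ≤-Reasoning
  IH : EdgeBound Gv L′ a cᵥ
  IH = rec Gv L′ a size′ (hypotheses-isolate G hyp (critical v x (proj₂ neighbour)) (proj₂ compsᵥ))
  z = proj₁ IH
  pairs : Fin a → ℕ
  pairs i = z i C 2
  size-z+1 : sum z + 1 ≡ card L
  size-z+1 = trans (cong (_+ 1) (proj₁ (proj₂ IH))) (card-remove L Lv)
  enlarged = enlarge-small-part z Δ
    (≤-trans (≤-reflexive (trans (+-comm 1 _) size-z+1)) (card-≤-stability*degree G Δ hyp Δ-max))
  z⁺ = proj₁ enlarged
  size-z⁺ : sum z⁺ ≡ suc (sum z)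
  size-z⁺ = proj₁ (proj₂ enlarged)
  without-v : a + sum pairs + card (∁ L) ≤ numEdges Gv + c
  without-v = ≤-pred (begin
    suc (a + sum pairs + card (∁ L))  ≡⟨ suc-+ʳ (a + sum pairs) (sym (card-∁-[]≔false L Lv)) ⟩
    a + sum pairs + card (∁ L′)       ≤⟨ proj₂ (proj₂ IH) ⟩
    numEdges Gv + cᵥ                  ≤⟨ +-monoʳ-≤ (numEdges Gv) cᵥ≤ ⟩
    numEdges Gv + suc c               ≡⟨ +-suc (numEdges Gv) c ⟩
    suc (numEdges Gv + c)             ∎)
    where open ≤-Reasoning
  bound-z⁺ : a + sum (λ i → z⁺ i C 2) + card (∁ L) ≤ numEdges G + c
  bound-z⁺ = begin
    a + sum (λ i → z⁺ i C 2) + card (∁ L)  ≤⟨ +-monoˡ-≤ (card (∁ L)) (+-monoʳ-≤ a (proj₂ (proj₂ enlarged))) ⟩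
    a + (sum pairs + Δ) + card (∁ L)       ≡⟨ move-Δ a (sum pairs) Δ _ ⟩
    a + sum pairs + card (∁ L) + Δ         ≤⟨ +-monoˡ-≤ Δ without-v ⟩
    numEdges Gv + c + Δ                    ≡⟨ trans (swap-last (numEdges Gv) c Δ) (cong (_+ c) (sym E≡)) ⟩
    numEdges G + c                         ∎
    where
    open ≤-Reasoning
    move-Δ : ∀ p q d r → p + (q + d) + r ≡ p + q + r + d
    move-Δ = solve-∀
    swap-last : ∀ p q r → p + q + r ≡ p + r + q
    swap-last = solve-∀

edgeBound : ∀ m → EdgeBoundBelow m
edgeBound m G L a size hyp with FinP.any? (λ w → L w ≟ᵇ true)
... | no nothing-live = edgeBound-nothing-live G (λ i → ¬-not (λ Li → nothing-live (i , Li))) hyp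
edgeBound zero G L a size hyp | yes (w , Lw) =
  contradiction (≤-trans (card-∋ L Lw) (≤-trans (m≤n+m _ _) size)) λ ()
edgeBound (suc m) G L a size hyp | yes (w , Lw)
  with FinP.any? (λ v → (L v ≟ᵇ true) ×-dec FinP.all? (λ j → adj G v j ≟ᵇ false))
... | yes (v , Lv , isolated) = edgeBound-isolated-vertex (edgeBound m) G size hyp Lv isolated
... | no no-isolated
  with FinP.any? (λ u → FinP.any? λ v →
         (adj G u v ≟ᵇ true) ×-dec ¬? (StableOfSize? (deleteEdge G u v) L (suc a)))
... | yes (u , v , uv , noncritical) = edgeBound-noncritical-edge (edgeBound m) G size hyp uv noncritical
... | no no-noncritical = edgeBound-all-critical (edgeBound m) G size hyp Lw has-neighbour critical
  where
  has-neighbour : ∀ v → L v ≡ true → ∃ λ j → adj G v j ≡ true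
  has-neighbour v Lv with FinP.any? (λ j → adj G v j ≟ᵇ true)
  ... | yes neighbour = neighbour
  ... | no none = ⊥-elim (no-isolated (v , Lv , λ j → ¬-not (λ vj → none (j , vj))))
  critical : ∀ u v → adj G u v ≡ true → StableOfSize (deleteEdge G u v) L (suc a)
  critical u v uv with StableOfSize? (deleteEdge G u v) L (suc a)
  ... | yes large = large
  ... | no none = ⊥-elim (no-noncritical (u , v , uv , none))

stable-∁-cover : ∀ {n} (G : Graph n) {S} → IsStable G S → IsVertexCover G (Subset.∁ S)
stable-∁-cover G {S} S-stable i j ij with i SubsetP.∈? S | j SubsetP.∈? S
... | no i∉S  | _       = inj₁ (SubsetP.x∉p⇒x∈∁p i∉S)
... | yes _   | no j∉S  = inj₂ (SubsetP.x∉p⇒x∈∁p j∉S)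
... | yes i∈S | yes j∈S = ⊥-elim (false≢true (trans (sym (S-stable i j i∈S j∈S)) ij))

cover-∁-stable : ∀ {n} (G : Graph n) {C} → IsVertexCover G C → IsStable G (Subset.∁ C)
cover-∁-stable G {C} C-cover i j i∈∁C j∈∁C with adj G i j in ij
... | false = refl
... | true with C-cover i j ij
...   | inj₁ i∈C = ⊥-elim (SubsetP.x∈∁p⇒x∉p i∈∁C i∈C)
...   | inj₂ j∈C = ⊥-elim (SubsetP.x∈∁p⇒x∉p j∈∁C j∈C)

stability+cover≡n : ∀ {n} (G : Graph n) {a t} →
                    IsStabilityNumber G a → IsCoverNumber G t → a + t ≡ n
stability+cover≡n {n} G {a} {t} ((S , S-stable , ∣S∣≡a) , maximum) ((C , C-cover , ∣C∣≡t) , minimum) =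
  ≤-antisym (begin
    a + t        ≤⟨ +-monoʳ-≤ a (≤-trans (minimum _ (stable-∁-cover G S-stable)) (≤-reflexive ∣∁S∣)) ⟩
    a + (n ∸ a)  ≡⟨ m+[n∸m]≡n (≤-trans (≤-reflexive (sym ∣S∣≡a)) (SubsetP.∣p∣≤n S)) ⟩
    n            ∎)
  (begin
    n            ≡⟨ m+[n∸m]≡n (≤-trans (≤-reflexive (sym ∣C∣≡t)) (SubsetP.∣p∣≤n C)) ⟨
    t + (n ∸ t)  ≤⟨ +-monoʳ-≤ t (≤-trans (≤-reflexive (sym ∣∁C∣)) (maximum _ (cover-∁-stable G C-cover))) ⟩
    t + a        ≡⟨ +-comm t a ⟩
    a + t        ∎)
  where
  open ≤-Reasoning
  ∣∁S∣ : Subset.∣ Subset.∁ S ∣ ≡ n ∸ a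
  ∣∁S∣ = trans (SubsetP.∣∁p∣≡n∸∣p∣ S) (cong (n ∸_) ∣S∣≡a)
  ∣∁C∣ : Subset.∣ Subset.∁ C ∣ ≡ n ∸ t
  ∣∁C∣ = trans (SubsetP.∣∁p∣≡n∸∣p∣ C) (cong (n ∸_) ∣C∣≡t)

card-lookup : ∀ {n} (p : Subset.Subset n) → card (Vec.lookup p) ≡ Subset.∣ p ∣
card-lookup Vec.[]          = refl
card-lookup (true  Vec.∷ p) = cong suc (card-lookup p)
card-lookup (false Vec.∷ p) = card-lookup p

stabilityNumber⇒Hypotheses : ∀ {n} (G : Graph n) {a c} →
  IsStabilityNumber G a → IsNumComponents G c → Hypotheses G (const true) a c
stabilityNumber⇒Hypotheses G ((S , S-stable , ∣S∣≡a) , maximum) comps = record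
  { outside-isolated = λ _ _ _ → refl
  ; attained         = Vec.lookup S
                     , (λ i j Si Sj → S-stable i j (VecP.lookup⇒[]= i S Si) (VecP.lookup⇒[]= j S Sj))
                     , (λ _ _ → refl)
                     , ≤-reflexive (sym (trans (card-lookup S) ∣S∣≡a))
  ; bounded          = λ T T-stable _ →
      ≤-trans (≤-reflexive (trans (card-cong (λ i → sym (VecP.lookup∘tabulate T i)))
                                  (card-lookup (Vec.tabulate T))))
              (maximum (Vec.tabulate T) λ i j i∈ j∈ →
                 T-stable i j (trans (sym (VecP.lookup∘tabulate T i)) (VecP.[]=⇒lookup i∈))
                              (trans (sym (VecP.lookup∘tabulate T j)) (VecP.[]=⇒lookup j∈)))
  ; components       = comps
  }

theorem3p2 : ∀ {n : ℕ} (G : Graph n) (a t c g : ℕ) →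
    IsStabilityNumber G a → IsCoverNumber G t → IsNumComponents G c →
    IsGamma a t g →
    a + g ≤ numEdges G + c
theorem3p2 {n} G a t c g stability cover comps (_ , g-minimal) = begin
  a + g                       ≤⟨ +-monoʳ-≤ a (g-minimal z sum-z) ⟩
  a + sumFin pairs            ≡⟨ cong (a +_) (sumFin≡sum pairs) ⟩
  a + sum pairs               ≡⟨ +-identityʳ _ ⟨
  a + sum pairs + 0           ≡⟨ cong (a + sum pairs +_) (card-const-false n) ⟨
  a + sum pairs + card {n} (const false) ≤⟨ proj₂ (proj₂ bound) ⟩
  numEdges G + c              ∎
  where
  open ≤-Reasoning
  bound = edgeBound _ G (const true) a ≤-refl (stabilityNumber⇒Hypotheses G stability comps)
  z = proj₁ bound
  pairs : Fin a → ℕ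
  pairs i = z i C 2
  sum-z : sumFin z ≡ a + t
  sum-z = trans (sumFin≡sum z) (trans (proj₁ (proj₂ bound))
                (trans (card-const-true n) (sym (stability+cover≡n G stability cover))))
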